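{- Let $G$ be a connected block graph. Then $MinLeaf(G)=p(G)$, i.e. the minimum number of leaves over all spanning trees of $G$ equals the number of pendant cliques of $G$.
   Context: All graphs are finite, simple and undirected. A block of a graph is a maximal 2-connected subgraph; $G$ is a block graph if every block is a complete graph. A cut-vertex is a vertex whose removal increases the number of connected components. A maximal clique of a block graph is pendant if it contains exactly one cut-vertex of $G$; $p(G)$ is the number of pendant cliques. $MinLeaf(G)$ is the smallest number of leaves (degree-one vertices) in a spanning tree of $G$.
   Formalization: The connected block graph G is also assumed to have at least one cut-vertex, that is, G is not a complete graph, in order to conclude MinLeaf(G) = p(G). The statement above fails without it. -}

module Defs where

open import Data.Nat using (ℕ; zero; suc; _≤_; _≟_)
open import Data.Bool using (Bool; true; false; if_then_else_)
open import Data.Fin using (Fin)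
open import Data.Fin.Subset using (Subset; _∈_; _⊆_; ⊤; _─_; ⁅_⁆; Nonempty)
open import Data.List using (List; []; _∷_; _++_; [_]; length; filter; map; allFin)
open import Data.Nat.ListAction using (sum)
open import Data.List.Relation.Unary.Linked using (Linked)
open import Data.List.Relation.Unary.Unique.Propositional using (Unique)
open import Data.List.Membership.Propositional using () renaming (_∈_ to _∈ₗ_)
open import Data.List.Relation.Unary.All using (All)
open import Data.Product using (Σ; ∃; ∃-syntax; _×_; _,_)
open import Relation.Binary.PropositionalEquality using (_≡_; _≢_)
open import Relation.Nullary using (¬_)

record Graph (n : ℕ) : Set where
  field
    adj    : Fin n → Fin n → Bool
    sym    : ∀ i j → adj i j ≡ adj j i
    irrefl : ∀ i → adj i i ≡ false
open Graph public

EdgeOf : ∀ {n} → (Fin n → Fin n → Bool) → Fin n → Fin n → Set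
EdgeOf M i j = M i j ≡ true

Adj : ∀ {n} → Graph n → Fin n → Fin n → Set
Adj G = EdgeOf (adj G)

data WalkIn {n} (E : Fin n → Fin n → Set) (S : Subset n) : Fin n → Fin n → Set where
  here : ∀ {u} → u ∈ S → WalkIn E S u u
  step : ∀ {u v w} → u ∈ S → E u v → WalkIn E S v w → WalkIn E S u w

ConnectedIn : ∀ {n} → (Fin n → Fin n → Set) → Subset n → Set
ConnectedIn E S = ∀ u w → u ∈ S → w ∈ S → WalkIn E S u w

Connected : ∀ {n} → Graph n → Set
Connected G = ConnectedIn (Adj G) ⊤

-- v is a cut-vertex of G: removing v increases the number of components,
-- i.e. some two vertices other than v lie in a common component of G
-- but in different components of G - v.
IsCutVertex : ∀ {n} → Graph n → Fin n → Set
IsCutVertex G v =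
  ∃[ u ] ∃[ w ] (u ≢ v × w ≢ v × WalkIn (Adj G) ⊤ u w × ¬ WalkIn (Adj G) (⊤ ─ ⁅ v ⁆) u w)

Nonseparable : ∀ {n} → Graph n → Subset n → Set
Nonseparable G S =
  Nonempty S × ConnectedIn (Adj G) S × (∀ v → v ∈ S → ConnectedIn (Adj G) (S ─ ⁅ v ⁆))

IsBlock : ∀ {n} → Graph n → Subset n → Set
IsBlock G S = Nonseparable G S × (∀ S′ → S ⊆ S′ → Nonseparable G S′ → S′ ⊆ S)

IsClique : ∀ {n} → Graph n → Subset n → Set
IsClique G S = ∀ i j → i ∈ S → j ∈ S → i ≢ j → Adj G i j

IsMaximalClique : ∀ {n} → Graph n → Subset n → Set
IsMaximalClique G S = IsClique G S × (∀ S′ → S ⊆ S′ → IsClique G S′ → S′ ⊆ S)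

IsBlockGraph : ∀ {n} → Graph n → Set
IsBlockGraph G = ∀ S → IsBlock G S → IsClique G S

IsPendantClique : ∀ {n} → Graph n → Subset n → Set
IsPendantClique G S =
  IsMaximalClique G S ×
  (∃[ v ] (v ∈ S × IsCutVertex G v × (∀ w → w ∈ S → IsCutVertex G w → w ≡ v)))

-- p(G) = k : the pendant cliques of G are exactly the entries of a
-- duplicate-free list of length k.
PendantCount : ∀ {n} → Graph n → ℕ → Set
PendantCount G k =
  Σ (List (Subset _)) λ L →
    Unique L × All (IsPendantClique G) L ×
    (∀ S → IsPendantClique G S → S ∈ₗ L) × length L ≡ k

HasCycle : ∀ {n} → (Fin n → Fin n → Set) → Set
HasCycle {n} E =
  Σ (Fin n) λ v → Σ (List (Fin n)) λ xs →
    2 ≤ length xs × Unique (v ∷ xs) × Linked E (v ∷ xs ++ [ v ])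

IsSpanningTree : ∀ {n} → Graph n → (Fin n → Fin n → Bool) → Set
IsSpanningTree G T =
  (∀ i j → T i j ≡ T j i) ×
  (∀ i j → T i j ≡ true → adj G i j ≡ true) ×
  ConnectedIn (EdgeOf T) ⊤ ×
  ¬ HasCycle (EdgeOf T)

degree : ∀ {n} → (Fin n → Fin n → Bool) → Fin n → ℕ
degree {n} T i = sum (map (λ j → if T i j then 1 else 0) (allFin n))

leaves : ∀ {n} → (Fin n → Fin n → Bool) → ℕ
leaves {n} T = length (filter (λ i → degree T i ≟ 1) (allFin n))

-- In a block graph two neighbours of x joined by a walk avoiding x are adjacent, since a
-- cycle lies in a single block. Hence the closed neighbourhood of a non-cut vertex is a clique, and the
-- only maximal clique containing it. Let S be a pendant clique with cut vertex v. A spanning tree enters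
-- S ∖ {v} from v; if no vertex of S ∖ {v} were a leaf, a walk could be continued without backtracking
-- inside S ∖ {v} until it repeats a vertex, which yields a cycle. These leaves are non-cut vertices, so
-- distinct pendant cliques receive distinct leaves.
--
-- Root G at a cut vertex r and order the vertices by BFS layer, then those without
-- neighbours in the next layer first, then by index. Giving every vertex its key-greatest neighbour of
-- smaller key as parent yields a spanning tree that runs through each block as a path, starting at the
-- vertex nearest to r and ending with the vertices from which deeper blocks hang; r itself has children
-- in two blocks. A leaf is thus the last vertex of a block from which nothing hangs: a non-cut vertex
-- whose closed neighbourhood is a pendant clique, different for different leaves.

{-# OPTIONS --safe #-}
module Submission where

open import Defs
open import Data.Nat using (ℕ; zero; suc; _+_; _*_; _∸_; _≤_; _<_; z≤n; s≤s; _<?_; _≟_)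
open import Data.Nat.Properties
open import Data.Nat.ListAction using (sum)
open import Data.Bool using (Bool; true; false; if_then_else_)
open import Data.Bool.Properties using () renaming (_≟_ to _≟ᵇ_)
open import Data.Fin using (Fin; toℕ) renaming (_≟_ to _≟ᶠ_)
open import Data.Fin.Properties using (any?; toℕ<n; toℕ-injective)
open import Data.Fin.Subset using (Subset; _∈_; _∉_; _⊆_; _⊂_; ⊤; _─_; _-_; ∣_∣; inside; outside)
open import Data.Fin.Subset.Properties
  using (∈⊤; x∈⁅x⁆; x∈p∧x≢y⇒x∈p-y; p─q⊆p; ⊆-antisym; p⊂q⇒∣p∣<∣q∣; ∣p∣≤n; _∈?_)
open import Data.Vec using (tabulate; _∷_)
import Data.Vec as Vec
open import Data.Vec.Properties using ([]=⇒lookup; lookup⇒[]=; lookup∘tabulate)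
open import Data.List using (List; []; _∷_; _++_; [_]; length; filter; map; allFin; _∷ʳ_; initLast; _∷ʳ′_)
open import Data.List.Properties using (length-++-sucʳ; length-tabulate; ++-assoc)
open import Data.List.Relation.Unary.Any using (here; there)
open import Data.List.Relation.Unary.All using (All; []; _∷_) renaming (lookup to All-lookup)
import Data.List.Relation.Unary.All as All
open import Data.List.Relation.Unary.All.Properties using (all-filter; ++⁻ˡ; ¬Any⇒All¬)
open import Data.List.Relation.Unary.AllPairs using ([]; _∷_)
open import Data.List.Relation.Unary.Linked using (Linked; []; [-]; _∷_)
import Data.List.Relation.Unary.Linked as Linked
open import Data.List.Relation.Unary.Linked.Properties using (Linked⇒AllPairs)
open import Data.List.Relation.Unary.Unique.Propositional using (Unique)
open import Data.List.Relation.Unary.Unique.Propositional.Properties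
  using (allFin⁺; filter⁺; Unique[x∷xs]⇒x∉xs)
open import Data.List.Membership.Propositional using () renaming (_∈_ to _∈ₗ_; _∉_ to _∉ₗ_)
open import Data.List.Membership.Propositional.Properties
  using (∈-allFin; ∈-filter⁺; ∈-filter⁻; ∈-∃++; ∈-++⁺ˡ; ∈-++⁺ʳ; ∈-++⁻)
import Data.List.Membership.DecPropositional as DecMembership
open import Data.List.Extrema.Nat
  using (argmin; argmax; argmin-all; argmax-all; f[argmin]≤f[xs]; f[xs]≤f[argmax])
open import Data.Product using (Σ; ∃; ∃-syntax; _×_; _,_; proj₁; proj₂)
open import Data.Sum using (_⊎_; inj₁; inj₂) renaming (swap to ⊎-swap; map to ⊎-map)
open import Data.Empty using (⊥; ⊥-elim)
open import Data.Unit using (tt) renaming (⊤ to Unit)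
open import Function using (_∘_; mk⇔)
open import Relation.Unary using (Decidable)
open import Relation.Nullary using (¬_; Dec; yes; no; does; contradiction)
open import Relation.Nullary.Decidable
  using (toSum; ¬?; _×-dec_; _⊎-dec_; dec-true; dec-false; does-⇔; decidable-stable; ¬¬-excluded-middle)
open import Relation.Binary.Definitions using (DecidableEquality; tri<; tri≈; tri>)
open import Relation.Binary.PropositionalEquality using (_≡_; _≢_; ≢-sym; refl; trans; cong; subst; subst₂)
import Relation.Binary.PropositionalEquality as ≡

dec-true⁻ : ∀ {A : Set} (a? : Dec A) → does a? ≡ true → A
dec-true⁻ (yes a) _ = a
dec-true⁻ (no _) ()

toSubset : ∀ {n} {P : Fin n → Set} → Decidable P → Subset n
toSubset P? = tabulate (λ x → does (P? x))

module _ {n} {P : Fin n → Set} (P? : Decidable P) where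

  ∈-toSubset⁺ : ∀ {x} → P x → x ∈ toSubset P?
  ∈-toSubset⁺ {x} px = lookup⇒[]= x _ (trans (lookup∘tabulate _ x) (dec-true (P? x) px))

  ∈-toSubset⁻ : ∀ {x} → x ∈ toSubset P? → P x
  ∈-toSubset⁻ {x} x∈ = dec-true⁻ (P? x) (trans (≡.sym (lookup∘tabulate _ x)) ([]=⇒lookup x∈))

x∈p─q⇒x∉q : ∀ {n} {x : Fin n} {p q : Subset n} → x ∈ p ─ q → x ∉ q
x∈p─q⇒x∉q {p = inside ∷ _} {outside ∷ _} Vec.here ()
x∈p─q⇒x∉q {p = _ ∷ _} {_ ∷ _} (Vec.there x∈) (Vec.there x∈q) = x∈p─q⇒x∉q x∈ x∈q

x∈p-y⇒x≢y : ∀ {n} {x y : Fin n} {p : Subset n} → x ∈ p - y → x ≢ y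
x∈p-y⇒x≢y {y = y} x∈ refl = x∈p─q⇒x∉q x∈ (x∈⁅x⁆ y)

-- Lists

module _ {A B : Set} (R : A → B → Set) where

  length-≤-by-injection : ∀ {xs : List A} {ys : List B} → Unique xs →
    (∀ {x} → x ∈ₗ xs → ∃ λ y → y ∈ₗ ys × R x y) →
    (∀ {x x′ y} → x ∈ₗ xs → x′ ∈ₗ xs → R x y → R x′ y → x ≡ x′) →
    length xs ≤ length ys
  length-≤-by-injection {[]} _ _ _ = z≤n
  length-≤-by-injection {x ∷ xs} (x≢xs ∷ xs-unique) image injective
    with y , y∈ys , Rxy ← image (here refl)
    with as , bs , refl ← ∈-∃++ y∈ys = begin
      suc (length xs)          ≤⟨ s≤s (length-≤-by-injection xs-unique image′ injective′) ⟩
      suc (length (as ++ bs))  ≡⟨ length-++-sucʳ as y bs ⟨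
      length (as ++ y ∷ bs)    ∎
    where
    open ≤-Reasoning
    injective′ : ∀ {x x′ y} → x ∈ₗ xs → x′ ∈ₗ xs → R x y → R x′ y → x ≡ x′
    injective′ x∈ x′∈ = injective (there x∈) (there x′∈)
    image′ : ∀ {x′} → x′ ∈ₗ xs → ∃ λ y′ → y′ ∈ₗ as ++ bs × R x′ y′
    image′ x′∈ with y′ , y′∈ , Rx′y′ ← image (there x′∈) with ∈-++⁻ as y′∈
    ... | inj₁ y′∈as         = y′ , ∈-++⁺ˡ y′∈as , Rx′y′
    ... | inj₂ (there y′∈bs) = y′ , ∈-++⁺ʳ as y′∈bs , Rx′y′
    ... | inj₂ (here refl)   = ⊥-elim (All-lookup x≢xs x′∈ (injective (here refl) (there x′∈) Rxy Rx′y′))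

unique-length≤ : ∀ {n} {xs : List (Fin n)} → Unique xs → length xs ≤ n
unique-length≤ {n} {xs} xs-unique = subst (length xs ≤_) (length-tabulate (λ i → i))
  (length-≤-by-injection _≡_ xs-unique (λ {x} _ → x , ∈-allFin x , refl) (λ _ _ e e′ → trans e (≡.sym e′)))

Unique-++-∷⁻ : ∀ {A : Set} (bs : List A) {a cs} → Unique (bs ++ a ∷ cs) → Unique (a ∷ bs)
Unique-++-∷⁻ [] _ = [] ∷ []
Unique-++-∷⁻ (b ∷ bs) (b≢ ∷ u) with a≢bs ∷ bs-unique ← Unique-++-∷⁻ bs u =
  (≢-sym (All-lookup b≢ (∈-++⁺ʳ bs (here refl))) ∷ a≢bs) ∷ ++⁻ˡ bs b≢ ∷ bs-unique

module _ {A : Set} {R : A → A → Set} where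

  Linked-++⁻ˡ : ∀ xs {ys} → Linked R (xs ++ ys) → Linked R xs
  Linked-++⁻ˡ [] _ = []
  Linked-++⁻ˡ (x ∷ []) _ = [-]
  Linked-++⁻ˡ (x ∷ y ∷ xs) (r ∷ rs) = r ∷ Linked-++⁻ˡ (y ∷ xs) rs

  Linked-last : ∀ xs {p q} → Linked R (xs ++ p ∷ q ∷ []) → R p q
  Linked-last [] (r ∷ _) = r
  Linked-last (_ ∷ []) (_ ∷ rs) = Linked-last [] rs
  Linked-last (_ ∷ y ∷ xs) (_ ∷ rs) = Linked-last (y ∷ xs) rs

  Linked-no-return : ∀ {S : A → A → Set} → (∀ {a b} → R a b → S a b) → (∀ {a b c} → S a b → S b c → S a c) →
                     (∀ {a} → ¬ S a a) → ∀ {v xs} → Linked R (v ∷ xs) → v ∉ₗ xs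
  Linked-no-return R⇒S S-trans S-irrefl walk v∈xs
    with v≺xs ∷ _ ← Linked⇒AllPairs S-trans (Linked.map R⇒S walk) = S-irrefl (All-lookup v≺xs v∈xs)

NonBacktracking : ∀ {A : Set} → List A → Set
NonBacktracking (a ∷ b ∷ c ∷ l) = a ≢ c × NonBacktracking (b ∷ c ∷ l)
NonBacktracking _ = Unit

module _ {A : Set} where

  NonBacktracking-tail : ∀ {a : A} l → NonBacktracking (a ∷ l) → NonBacktracking l
  NonBacktracking-tail [] _ = tt
  NonBacktracking-tail (b ∷ []) _ = tt
  NonBacktracking-tail (b ∷ c ∷ l) (_ , nb) = nb

  NonBacktracking-∷ʳ : ∀ (l : List A) {v} → Unique l → v ∉ₗ l → NonBacktracking (l ∷ʳ v)
  NonBacktracking-∷ʳ [] _ _ = tt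
  NonBacktracking-∷ʳ (a ∷ []) _ _ = tt
  NonBacktracking-∷ʳ (a ∷ b ∷ []) _ v∉ = (λ a≡v → v∉ (here (≡.sym a≡v))) , tt
  NonBacktracking-∷ʳ (a ∷ b ∷ c ∷ l) (a≢ ∷ u) v∉ =
    All-lookup a≢ (there (here refl)) , NonBacktracking-∷ʳ (b ∷ c ∷ l) u (v∉ ∘ there)

  NonBacktracking-close : ∀ {v} xs → Unique (v ∷ xs) → 2 ≤ length xs → NonBacktracking (v ∷ xs ∷ʳ v)
  NonBacktracking-close [] _ ()
  NonBacktracking-close (_ ∷ []) _ (s≤s ())
  NonBacktracking-close (x ∷ y ∷ l) u@((_ ∷ v≢y ∷ _) ∷ u′) _ =
    v≢y , NonBacktracking-∷ʳ (x ∷ y ∷ l) u′ (Unique[x∷xs]⇒x∉xs u)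

LastStep : ∀ {A : Set} → (A → A → Set) → A → A → List A → Set
LastStep R a b []      = R a b
LastStep R a b (c ∷ l) = LastStep R b c l

LastStep-++ : ∀ {A : Set} {R : A → A → Set} {a b} ys {p q} → R p q → LastStep R a b (ys ++ p ∷ q ∷ [])
LastStep-++ []       r = r
LastStep-++ (_ ∷ ys) r = LastStep-++ ys r

module _ {n} {E : Fin n → Fin n → Set} (irreflexive : ∀ {x} → ¬ E x x) where

  unique-or-cycle : ∀ xs → Linked E xs → NonBacktracking xs → Unique xs ⊎ HasCycle E
  unique-or-cycle [] _ _ = inj₁ []
  unique-or-cycle (a ∷ xs) walk nb with unique-or-cycle xs (Linked.tail walk) (NonBacktracking-tail xs nb)
  ... | inj₂ cycle = inj₂ cycle
  ... | inj₁ xs-unique with DecMembership._∈?_ _≟ᶠ_ a xs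
  ...   | no a∉xs = inj₁ (¬Any⇒All¬ xs a∉xs ∷ xs-unique)
  ...   | yes a∈xs with bs , cs , refl ← ∈-∃++ a∈xs = inj₂ (cycle-at bs walk nb xs-unique)
    where
    cycle-at : ∀ bs {cs} → Linked E (a ∷ bs ++ a ∷ cs) → NonBacktracking (a ∷ bs ++ a ∷ cs) →
               Unique (bs ++ a ∷ cs) → HasCycle E
    cycle-at [] (e ∷ _) _ _ = ⊥-elim (irreflexive e)
    cycle-at (b ∷ []) _ (a≢a , _) _ = ⊥-elim (a≢a refl)
    cycle-at bs@(_ ∷ _ ∷ _) {cs} walk _ u =
      a , bs , s≤s (s≤s z≤n) , Unique-++-∷⁻ bs u ,
      Linked-++⁻ˡ (a ∷ bs ∷ʳ a) (subst (Linked E) (≡.sym (++-assoc (a ∷ bs) [ a ] cs)) walk)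

module _ {n} {P : Fin n → Set} (P? : Decidable P) (f : Fin n → ℕ) where

  private
    candidates : List (Fin n)
    candidates = filter P? (allFin n)

    candidate : ∀ {c} → P c → c ∈ₗ candidates
    candidate {c} pc = ∈-filter⁺ P? (∈-allFin c) pc

  least-by : ∀ {a} → P a → ∃ λ b → P b × ∀ {c} → P c → f b ≤ f c
  least-by {a} pa = argmin f a candidates , argmin-all f pa (all-filter P? (allFin n)) ,
                   λ pc → All-lookup (f[argmin]≤f[xs] a candidates) (candidate pc)

  greatest-by : ∀ {a} → P a → ∃ λ b → P b × ∀ {c} → P c → f c ≤ f b
  greatest-by {a} pa = argmax f a candidates , argmax-all f pa (all-filter P? (allFin n)) ,
                   λ pc → All-lookup (f[xs]≤f[argmax] a candidates) (candidate pc)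

least-witness : ∀ {P : ℕ → Set} → Decidable P → ∀ b → P b → ∃ λ m → P m × ∀ {k} → P k → m ≤ k
least-witness P? b pb with P? 0
... | yes p0 = 0 , p0 , λ _ → z≤n
least-witness P? zero pb | no ¬p0 = contradiction pb ¬p0
least-witness P? (suc b) pb | no ¬p0 with m , pm , least ← least-witness (P? ∘ suc) b pb =
  suc m , pm , λ { {zero} p0 → contradiction p0 ¬p0 ; {suc k} pk → s≤s (least pk) }

countTrue : ∀ {A : Set} → (A → Bool) → List A → ℕ
countTrue f xs = sum (map (λ x → if f x then 1 else 0) xs)

module _ {A : Set} (f : A → Bool) where

  countTrue≡0 : ∀ xs → (∀ {x} → x ∈ₗ xs → f x ≡ false) → countTrue f xs ≡ 0
  countTrue≡0 [] _ = refl
  countTrue≡0 (x ∷ xs) none rewrite none (here refl) = countTrue≡0 xs (none ∘ there)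

  countTrue≡1 : ∀ {xs a} → Unique xs → a ∈ₗ xs → f a ≡ true → (∀ {x} → f x ≡ true → x ≡ a) →
                countTrue f xs ≡ 1
  countTrue≡1 {x ∷ xs} (x∉ ∷ _) (here refl) fx only rewrite fx = cong suc (countTrue≡0 xs false-on-xs)
    where
    false-on-xs : ∀ {y} → y ∈ₗ xs → f y ≡ false
    false-on-xs {y} y∈ with f y in fy
    ... | false = refl
    ... | true = ⊥-elim (All-lookup x∉ y∈ (≡.sym (only fy)))
  countTrue≡1 {x ∷ xs} (x∉ ∷ u) (there a∈) fa only with f x in fx
  ... | true  = ⊥-elim (All-lookup x∉ a∈ (only fx))
  ... | false = countTrue≡1 u a∈ fa only

  1≤countTrue : ∀ {xs a} → a ∈ₗ xs → f a ≡ true → 1 ≤ countTrue f xs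
  1≤countTrue {x ∷ xs} (here refl) fa rewrite fa = s≤s z≤n
  1≤countTrue {x ∷ xs} (there a∈) fa with f x
  ... | true  = s≤s z≤n
  ... | false = 1≤countTrue a∈ fa

  2≤countTrue : ∀ {xs a b} → a ∈ₗ xs → b ∈ₗ xs → a ≢ b → f a ≡ true → f b ≡ true → 2 ≤ countTrue f xs
  2≤countTrue (here refl) (here refl) a≢b _ _ = ⊥-elim (a≢b refl)
  2≤countTrue (here refl) (there b∈) _ fa fb rewrite fa = s≤s (1≤countTrue b∈ fb)
  2≤countTrue (there a∈) (here refl) _ fa fb rewrite fb = s≤s (1≤countTrue a∈ fa)
  2≤countTrue {x ∷ xs} (there a∈) (there b∈) a≢b fa fb with f x
  ... | true  = s≤s (1≤countTrue a∈ fa)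
  ... | false = 2≤countTrue a∈ b∈ a≢b fa fb

another-true : ∀ {n} (f : Fin n → Bool) {p} → countTrue f (allFin n) ≢ 1 → f p ≡ true →
               ∃ λ q → f q ≡ true × p ≢ q
another-true f {p} count≢1 fp with any? (λ q → (f q ≟ᵇ true) ×-dec ¬? (p ≟ᶠ q))
... | yes other = other
... | no none = ⊥-elim (count≢1 (countTrue≡1 f (allFin⁺ _) (∈-allFin p) fp only-p))
  where
  only-p : ∀ {q} → f q ≡ true → q ≡ p
  only-p {q} fq = ≡.sym (decidable-stable (p ≟ᶠ q) λ p≢q → none (q , fq , p≢q))

module _ {N : ℕ} where

  mixed-radix-< : ∀ {a b s t} → a < b → s < N → a * N + s < b * N + t
  mixed-radix-< {a} {b} {s} {t} a<b s<N = begin-strict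
    a * N + s   <⟨ +-monoʳ-< (a * N) s<N ⟩
    a * N + N   ≡⟨ +-comm (a * N) N ⟩
    suc a * N   ≤⟨ *-monoˡ-≤ N a<b ⟩
    b * N       ≤⟨ m≤m+n (b * N) t ⟩
    b * N + t   ∎
    where open ≤-Reasoning

  mixed-radix-≤⁻ : ∀ {a b s t} → a * N + s ≤ b * N + t → t < N → a ≤ b
  mixed-radix-≤⁻ as≤bt t<N = ≮⇒≥ λ b<a → <⇒≱ (mixed-radix-< b<a t<N) as≤bt

  mixed-radix-injective : ∀ {a b s t} → a * N + s ≡ b * N + t → s < N → t < N → s ≡ t
  mixed-radix-injective {a} {b} {s} {t} as≡bt s<N t<N =
    +-cancelˡ-≡ (a * N) s t (trans as≡bt (cong (λ c → c * N + t) (≡.sym a≡b)))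
    where
    a≡b : a ≡ b
    a≡b = ≤-antisym (mixed-radix-≤⁻ (≤-reflexive as≡bt) t<N) (mixed-radix-≤⁻ (≤-reflexive (≡.sym as≡bt)) s<N)

-- Walks and paths

data Walk {A : Set} (E : A → A → Set) (P : A → Set) : A → A → Set where
  stop : ∀ {u} → P u → Walk E P u u
  hop  : ∀ {u v w} → P u → E u v → Walk E P v w → Walk E P u w

module _ {A : Set} {E : A → A → Set} where

  infixr 5 _++ʷ_
  _++ʷ_ : ∀ {P u v w} → Walk E P u v → Walk E P v w → Walk E P u w
  stop _    ++ʷ q = q
  hop p e r ++ʷ q = hop p e (r ++ʷ q)

  mapʷ : ∀ {P Q : A → Set} {u w} → (∀ {z} → P z → Q z) → Walk E P u w → Walk E Q u w
  mapʷ f (stop p)    = stop (f p)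
  mapʷ f (hop p e r) = hop (f p) e (mapʷ f r)

  last-P : ∀ {P u w} → Walk E P u w → P w
  last-P (stop p)    = p
  last-P (hop _ _ r) = last-P r

  _∷ʷʳ_ : ∀ {P u v w} → Walk E P u v → E v w × P w → Walk E P u w
  r ∷ʷʳ (e , p) = r ++ʷ hop (last-P r) e (stop p)

  reverseʷ : (∀ {a b} → E a b → E b a) → ∀ {P u w} → Walk E P u w → Walk E P w u
  reverseʷ E-sym (stop p)    = stop p
  reverseʷ E-sym (hop p e r) = reverseʷ E-sym r ∷ʷʳ (E-sym e , p)

  exit-edge : ∀ {P W : A → Set} {u v} → (∀ {x y} → W x → E x y → W y ⊎ y ≡ v) → ¬ W v →
              Walk E P u v → W u → ∃ λ x → W x × E x v
  exit-edge closed ¬Wv (stop _) Wu = ⊥-elim (¬Wv Wu)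
  exit-edge closed ¬Wv (hop _ e r) Wu with closed Wu e
  ... | inj₁ Wu′ = exit-edge closed ¬Wv r Wu′
  ... | inj₂ refl = _ , Wu , e

module _ {n} {E : Fin n → Fin n → Set} where

  toWalkIn : ∀ {P : Fin n → Set} {S u w} → (∀ {z} → P z → z ∈ S) → Walk E P u w → WalkIn E S u w
  toWalkIn f (stop p)    = here (f p)
  toWalkIn f (hop p e r) = step (f p) e (toWalkIn f r)

  fromWalkIn : ∀ {S u w} → WalkIn E S u w → Walk E (_∈ S) u w
  fromWalkIn (here u∈)     = stop u∈
  fromWalkIn (step u∈ e r) = hop u∈ e (fromWalkIn r)

  hub⇒ConnectedIn : (∀ {a b} → E a b → E b a) → ∀ {S h} → (∀ {a} → a ∈ S → Walk E (_∈ S) a h) →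
                    ConnectedIn E S
  hub⇒ConnectedIn E-sym to-hub _ _ a∈ b∈ = toWalkIn (λ z∈ → z∈) (to-hub a∈ ++ʷ reverseʷ E-sym (to-hub b∈))

data Path {A : Set} (E : A → A → Set) : A → A → List A → Set where
  single : ∀ {u} → Path E u u [ u ]
  link   : ∀ {u v w vs} → E u v → Path E v w vs → u ∉ₗ vs → Path E u w (u ∷ vs)

module _ {A : Set} {E : A → A → Set} where

  Path-start∈ : ∀ {u w vs} → Path E u w vs → u ∈ₗ vs
  Path-start∈ single       = here refl
  Path-start∈ (link _ _ _) = here refl

  Path-end∈ : ∀ {u w vs} → Path E u w vs → w ∈ₗ vs
  Path-end∈ single       = here refl
  Path-end∈ (link _ p _) = there (Path-end∈ p)

  Path-suffix : ∀ {v w vs y} → Path E v w vs → y ∈ₗ vs →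
                ∃ λ ws → Path E y w ws × (∀ {z} → z ∈ₗ ws → z ∈ₗ vs)
  Path-suffix single (here refl) = _ , single , λ z∈ → z∈
  Path-suffix p@(link _ _ _) (here refl) = _ , p , λ z∈ → z∈
  Path-suffix (link _ p _) (there y∈) with ws , q , ws⊆ ← Path-suffix p y∈ = ws , q , there ∘ ws⊆

  Path-to-end : ∀ {u w vs a} → Path E u w vs → a ∈ₗ vs → Walk E (_∈ₗ vs) a w
  Path-to-end single (here refl) = stop (here refl)
  Path-to-end (link e p _) (here refl) = hop (here refl) e (mapʷ there (Path-to-end p (Path-start∈ p)))
  Path-to-end (link _ p _) (there a∈) = mapʷ there (Path-to-end p a∈)

module _ {A : Set} {E : A → A → Set} (_≟_ : DecidableEquality A) where

  walk⇒path : ∀ {P u w} → Walk E P u w → ∃ λ vs → Path E u w vs × All P vs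
  walk⇒path (stop p) = _ , single , p ∷ []
  walk⇒path {u = u} (hop p e r) with vs , path , all ← walk⇒path r with DecMembership._∈?_ _≟_ u vs
  ... | yes u∈vs = let ws , path′ , ws⊆ = Path-suffix path u∈vs
                   in ws , path′ , All.tabulate (All-lookup all ∘ ws⊆)
  ... | no u∉vs  = u ∷ vs , link e path u∉vs , p ∷ all

  Path-avoiding : (∀ {a b} → E a b → E b a) → ∀ {u z vs a w} → Path E u z vs → a ∈ₗ vs → a ≢ w →
                  Walk E (λ t → t ∈ₗ vs × t ≢ w) a u ⊎ Walk E (λ t → t ∈ₗ vs × t ≢ w) a z
  Path-avoiding E-sym single (here refl) a≢w = inj₁ (stop (here refl , a≢w))
  Path-avoiding E-sym (link _ _ _) (here refl) a≢w = inj₁ (stop (here refl , a≢w))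
  Path-avoiding E-sym {u = u} {w = w} (link {vs = vs} e p u∉) (there a∈) a≢w with u ≟ w
  ... | yes refl = inj₂ (mapʷ (λ t∈ → there t∈ , λ { refl → u∉ t∈ }) (Path-to-end p a∈))
  ... | no u≢w = ⊎-map (λ q → mapʷ lift q ∷ʷʳ (E-sym e , here refl , u≢w)) (mapʷ lift)
                       (Path-avoiding E-sym p a∈ a≢w)
    where
    lift : ∀ {t} → t ∈ₗ vs × t ≢ w → t ∈ₗ u ∷ vs × t ≢ w
    lift (t∈ , t≢w) = there t∈ , t≢w

-- Forests and trees given by parent pointers

module _ {n} {E : Fin n → Fin n → Set} (irreflexive : ∀ {x} → ¬ E x x) (acyclic : ¬ HasCycle E) where

  module _ {W : Fin n → Set} {v}
           (continue : ∀ {p x} → W x → E p x → ∃ λ q → E x q × p ≢ q × (W q ⊎ q ≡ v)) where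

    private
      grow : ∀ fuel {p x} → E p x → W x → ∃ λ l →
             Linked E (p ∷ x ∷ l) × NonBacktracking (p ∷ x ∷ l) × (v ∈ₗ l ⊎ fuel ≤ length l)
      grow zero e Wx = [] , e ∷ [-] , tt , inj₂ z≤n
      grow (suc fuel) e Wx with q , e′ , p≢q , Wq⊎q≡v ← continue Wx e with Wq⊎q≡v
      ... | inj₂ refl = [ q ] , e ∷ e′ ∷ [-] , (p≢q , tt) , inj₁ (here refl)
      ... | inj₁ Wq with l , walk , nb , long ← grow fuel e′ Wq =
        q ∷ l , e ∷ walk , (p≢q , nb) , ⊎-map there s≤s long

    -- A walk from v into W that can always go on without backtracking must repeat a vertex.
    no-endless-region : ∀ {x} → E v x → W x → ⊥
    no-endless-region e Wx
      with l , walk , nb , long ← grow n e Wx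
      with unique-or-cycle irreflexive (v ∷ _ ∷ l) walk nb | long
    ... | inj₂ cycle  | _        = acyclic cycle
    ... | inj₁ unique | inj₁ v∈l = Unique[x∷xs]⇒x∉xs unique (there v∈l)
    ... | inj₁ unique | inj₂ n≤l = 1+n≰n (≤-trans (n≤1+n _) (≤-trans (unique-length≤ unique) n≤l))

module ParentTree {n} (root : Fin n) (parent : Fin n → Fin n) (key : Fin n → ℕ)
                  (key-parent< : ∀ {x} → x ≢ root → key (parent x) < key x) where

  ChildOf : Fin n → Fin n → Set
  ChildOf c x = c ≢ root × parent c ≡ x

  TreeEdge : Fin n → Fin n → Set
  TreeEdge x y = ChildOf x y ⊎ ChildOf y x

  childOf? : ∀ c x → Dec (ChildOf c x)
  childOf? c x = ¬? (c ≟ᶠ root) ×-dec (parent c ≟ᶠ x)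

  tree : Fin n → Fin n → Bool
  tree x y = does (childOf? x y ⊎-dec childOf? y x)

  tree⁺ : ∀ {x y} → TreeEdge x y → tree x y ≡ true
  tree⁺ {x} {y} = dec-true (childOf? x y ⊎-dec childOf? y x)

  tree⁻ : ∀ {x y} → tree x y ≡ true → TreeEdge x y
  tree⁻ {x} {y} = dec-true⁻ (childOf? x y ⊎-dec childOf? y x)

  tree-sym : ∀ x y → tree x y ≡ tree y x
  tree-sym x y =
    does-⇔ (mk⇔ ⊎-swap ⊎-swap) (childOf? x y ⊎-dec childOf? y x) (childOf? y x ⊎-dec childOf? x y)

  key-child : ∀ {c x} → ChildOf c x → key x < key c
  key-child (c≢root , refl) = key-parent< c≢root

  walk-to-root : ∀ x → Walk (EdgeOf tree) (_∈ ⊤) x root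
  walk-to-root x = go (suc (key x)) ≤-refl
    where
    go : ∀ fuel {x} → key x < fuel → Walk (EdgeOf tree) (_∈ ⊤) x root
    go (suc fuel) {x} x<fuel with x ≟ᶠ root
    ... | yes refl = stop ∈⊤
    ... | no x≢root =
      hop ∈⊤ (tree⁺ (inj₁ (x≢root , refl))) (go fuel (≤-trans (key-parent< x≢root) (≤-pred x<fuel)))

  tree-connected : ConnectedIn (EdgeOf tree) ⊤
  tree-connected = hub⇒ConnectedIn (λ {a} {b} → trans (tree-sym b a)) (λ {a} _ → walk-to-root a)

  descends-forever : ∀ {a b} l → Linked TreeEdge (a ∷ b ∷ l) → NonBacktracking (a ∷ b ∷ l) → ChildOf b a →
                     Linked (λ x y → ChildOf y x) (a ∷ b ∷ l)
  descends-forever [] _ _ b↓ = b↓ ∷ [-]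
  descends-forever (c ∷ l) (_ ∷ e ∷ walk) (a≢c , nb) b↓ with e
  ... | inj₁ (_ , refl) = ⊥-elim (a≢c (≡.sym (proj₂ b↓)))
  ... | inj₂ c↓ = b↓ ∷ descends-forever l (e ∷ walk) nb c↓

  ascends-if-last-ascends : ∀ {a b} l → Linked TreeEdge (a ∷ b ∷ l) → NonBacktracking (a ∷ b ∷ l) →
                            LastStep ChildOf a b l → Linked ChildOf (a ∷ b ∷ l)
  ascends-if-last-ascends [] _ _ a↑ = a↑ ∷ [-]
  ascends-if-last-ascends (c ∷ l) (e ∷ walk) (a≢c , nb) last↑
    with asc@(b↑ ∷ _) ← ascends-if-last-ascends l walk nb last↑ with e
  ... | inj₁ a↑ = a↑ ∷ asc
  ... | inj₂ b↓ = ⊥-elim (a≢c (trans (≡.sym (proj₂ b↓)) (proj₂ b↑)))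

  private
    ascent-no-return : ∀ {v xs} → Linked ChildOf (v ∷ xs) → v ∉ₗ xs
    ascent-no-return = Linked-no-return key-child (λ b<a c<b → <-trans c<b b<a) (<-irrefl refl)

    descent-no-return : ∀ {v xs} → Linked (λ x y → ChildOf y x) (v ∷ xs) → v ∉ₗ xs
    descent-no-return = Linked-no-return key-child <-trans (<-irrefl refl)

    returns : ∀ {v x₁ xₘ : Fin n} ys → v ∈ₗ x₁ ∷ ys ++ xₘ ∷ v ∷ []
    returns ys = there (∈-++⁺ʳ ys (there (here refl)))

    -- Without backtracking a walk climbs towards the root and then only descends, so a closed one would
    -- have to turn at v, making both x₁ and xₘ the parent of v.
    no-closed-walk : ∀ {v x₁ xₘ} ys → Linked TreeEdge (v ∷ x₁ ∷ ys ++ xₘ ∷ v ∷ []) →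
                     NonBacktracking (v ∷ x₁ ∷ ys ++ xₘ ∷ v ∷ []) → x₁ ≢ xₘ → ⊥
    no-closed-walk {v} {x₁} ys walk nb x₁≢xₘ with Linked.head walk | Linked-last (v ∷ x₁ ∷ ys) walk
    ... | inj₁ v↑  | inj₂ v↓  = x₁≢xₘ (trans (≡.sym (proj₂ v↑)) (proj₂ v↓))
    ... | inj₂ x₁↓ | _        = descent-no-return (descends-forever _ walk nb x₁↓) (returns ys)
    ... | inj₁ _   | inj₁ xₘ↑ =
      ascent-no-return (ascends-if-last-ascends _ walk nb (LastStep-++ ys xₘ↑)) (returns ys)

  acyclic : ¬ HasCycle (EdgeOf tree)
  acyclic (v , xs , 2≤m , unique , cycle) with initLast xs
  acyclic (v , _ , () , _ , _)    | []
  acyclic (v , _ , s≤s () , _ , _) | [] ∷ʳ′ _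
  acyclic (v , _ , 2≤m , unique@(_ ∷ x₁≢ ∷ _) , cycle) | (x₁ ∷ ys) ∷ʳ′ xₘ =
    no-closed-walk ys (subst (Linked TreeEdge) assoc (Linked.map tree⁻ cycle))
                      (subst NonBacktracking assoc (NonBacktracking-close _ unique 2≤m))
                      (All-lookup x₁≢ (∈-++⁺ʳ ys (here refl)))
    where
    assoc : v ∷ x₁ ∷ (ys ∷ʳ xₘ) ∷ʳ v ≡ v ∷ x₁ ∷ ys ++ xₘ ∷ v ∷ []
    assoc = cong (λ l → v ∷ x₁ ∷ l) (++-assoc ys [ xₘ ] [ v ])

  isSpanningTree : (G : Graph n) → (∀ {x} → x ≢ root → Adj G x (parent x)) → IsSpanningTree G tree
  isSpanningTree G adj-parent = tree-sym , tree⊆G , tree-connected , acyclic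
    where
    tree⊆G : ∀ i j → tree i j ≡ true → adj G i j ≡ true
    tree⊆G i j e with tree⁻ {i} {j} e
    ... | inj₁ (i≢root , refl) = adj-parent i≢root
    ... | inj₂ (j≢root , refl) = trans (Graph.sym G i j) (adj-parent j≢root)

  degree≢1 : ∀ {x a b} → TreeEdge x a → TreeEdge x b → a ≢ b → degree tree x ≢ 1
  degree≢1 {x} xa xb a≢b degree≡1 =
    1+n≰n (subst (2 ≤_) degree≡1 (2≤countTrue (tree x) (∈-allFin _) (∈-allFin _) a≢b (tree⁺ xa) (tree⁺ xb)))

  degree≢1-if-child : ∀ {x c} → x ≢ root → ChildOf c x → degree tree x ≢ 1
  degree≢1-if-child {x} x≢root c-child = degree≢1 (inj₁ (x≢root , refl)) (inj₂ c-child) parent≢c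
    where
    parent≢c : parent x ≢ _
    parent≢c refl = <-asym (key-parent< x≢root) (key-child c-child)

-- Block graphs

module GraphBasics {n} (G : Graph n) where

  Adj-sym : ∀ {x y} → Adj G x y → Adj G y x
  Adj-sym {x} {y} = trans (Graph.sym G y x)

  Adj-irrefl : ∀ {x} → ¬ Adj G x x
  Adj-irrefl {x} e with () ← trans (≡.sym (Graph.irrefl G x)) e

  Adj⇒≢ : ∀ {x y} → Adj G x y → x ≢ y
  Adj⇒≢ e refl = Adj-irrefl e

  Adj? : ∀ x y → Dec (Adj G x y)
  Adj? x y = adj G x y ≟ᵇ true

  avoiding⇒WalkIn : ∀ {v a b} → Walk (Adj G) (_≢ v) a b → WalkIn (Adj G) (⊤ - v) a b
  avoiding⇒WalkIn = toWalkIn (x∈p∧x≢y⇒x∈p-y ∈⊤)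

  WalkIn⇒avoiding : ∀ {v a b} → WalkIn (Adj G) (⊤ - v) a b → Walk (Adj G) (_≢ v) a b
  WalkIn⇒avoiding = mapʷ x∈p-y⇒x≢y ∘ fromWalkIn

module BlockGraph {n} (G : Graph n) (block-graph : IsBlockGraph G) where

  open GraphBasics G

  ¬¬-block⊇ : ∀ {S} → Nonseparable G S → ¬ ¬ (∃ λ B → IsBlock G B × S ⊆ B)
  ¬¬-block⊇ {S} = grow (suc (n ∸ ∣ S ∣)) ≤-refl
    where
    grow : ∀ fuel {S} → n ∸ ∣ S ∣ < fuel → Nonseparable G S → ¬ ¬ (∃ λ B → IsBlock G B × S ⊆ B)
    grow (suc fuel) {S} bound ns ¬block =
      ¬¬-excluded-middle {A = ∃ λ S′ → S ⊂ S′ × Nonseparable G S′} λ where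
        (yes (S′ , S⊂S′ , ns′)) →
          grow fuel (≤-trans (∸-monoʳ-< (p⊂q⇒∣p∣<∣q∣ S⊂S′) (∣p∣≤n S′)) (≤-pred bound)) ns′
               λ (B , B-block , S′⊆B) → ¬block (B , B-block , λ x∈ → S′⊆B (proj₁ S⊂S′ x∈))
        (no ¬larger) → ¬block (S , (ns , maximal-if ¬larger) , λ x∈ → x∈)
      where
      maximal-if : ¬ (∃ λ S′ → S ⊂ S′ × Nonseparable G S′) → ∀ S′ → S ⊆ S′ → Nonseparable G S′ → S′ ⊆ S
      maximal-if ¬larger S′ S⊆S′ ns′ {x} x∈S′ with x ∈? S
      ... | yes x∈S = x∈S
      ... | no x∉S = ⊥-elim (¬larger (S′ , ((λ y∈ → S⊆S′ y∈) , x , x∈S′ , x∉S) , ns′))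

  Nonseparable⇒IsClique : ∀ {S} → Nonseparable G S → IsClique G S
  Nonseparable⇒IsClique ns i j i∈ j∈ i≢j = decidable-stable (Adj? i j) λ ¬adj →
    ¬¬-block⊇ ns λ (B , B-block , S⊆B) → ¬adj (block-graph B B-block i j (S⊆B i∈) (S⊆B j∈) i≢j)

  module _ {x y z vs} (xy : Adj G x y) (xz : Adj G x z) (path : Path (Adj G) y z vs) (avoids : All (_≢ x) vs)
    where

    private
      apex? : ∀ t → Dec (t ≡ x ⊎ t ∈ₗ vs)
      apex? t = t ≟ᶠ x ⊎-dec DecMembership._∈?_ _≟ᶠ_ t vs

    cone : Subset n
    cone = toSubset apex?

    path⊆cone : ∀ {t} → t ∈ₗ vs → t ∈ cone
    path⊆cone t∈ = ∈-toSubset⁺ apex? (inj₂ t∈)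

    cone-nonseparable : Nonseparable G cone
    cone-nonseparable = (x , ∈-toSubset⁺ apex? (inj₁ refl)) , hub⇒ConnectedIn Adj-sym to-x , deletion
      where
      to-x : ∀ {a} → a ∈ cone → Walk (Adj G) (_∈ cone) a x
      to-x a∈ with ∈-toSubset⁻ apex? a∈
      ... | inj₁ refl = stop a∈
      ... | inj₂ a∈vs = mapʷ path⊆cone (Path-to-end path a∈vs)
                        ∷ʷʳ (Adj-sym xz , ∈-toSubset⁺ apex? (inj₁ refl))
      deletion : ∀ w → w ∈ cone → ConnectedIn (Adj G) (cone - w)
      deletion w _ with w ≟ᶠ x
      ... | yes refl = hub⇒ConnectedIn Adj-sym to-z
        where
        to-z : ∀ {a} → a ∈ cone - x → Walk (Adj G) (_∈ cone - x) a z
        to-z a∈ with ∈-toSubset⁻ apex? (p─q⊆p _ _ a∈)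
        ... | inj₁ refl = ⊥-elim (x∈p-y⇒x≢y a∈ refl)
        ... | inj₂ a∈vs = mapʷ (λ t∈ → x∈p∧x≢y⇒x∈p-y (path⊆cone t∈) (All-lookup avoids t∈))
                               (Path-to-end path a∈vs)
      ... | no w≢x = hub⇒ConnectedIn Adj-sym to-x′
        where
        kept : ∀ {t} → t ∈ₗ vs × t ≢ w → t ∈ cone - w
        kept (t∈ , t≢w) = x∈p∧x≢y⇒x∈p-y (path⊆cone t∈) t≢w
        x-inside : x ∈ cone - w
        x-inside = x∈p∧x≢y⇒x∈p-y (∈-toSubset⁺ apex? (inj₁ refl)) (≢-sym w≢x)
        to-x′ : ∀ {a} → a ∈ cone - w → Walk (Adj G) (_∈ cone - w) a x
        to-x′ a∈ with ∈-toSubset⁻ apex? (p─q⊆p _ _ a∈)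
        ... | inj₁ refl = stop a∈
        ... | inj₂ a∈vs with Path-avoiding _≟ᶠ_ Adj-sym path a∈vs (x∈p-y⇒x≢y a∈)
        ...   | inj₁ to-y = mapʷ kept to-y ∷ʷʳ (Adj-sym xy , x-inside)
        ...   | inj₂ to-z = mapʷ kept to-z ∷ʷʳ (Adj-sym xz , x-inside)

  -- A cycle through x lies inside a single block, which is a clique.
  detour : ∀ {x y z} → Adj G x y → Adj G x z → y ≢ z → Walk (Adj G) (_≢ x) y z → Adj G y z
  detour xy xz y≢z walk with vs , path , avoids ← walk⇒path _≟ᶠ_ walk =
    Nonseparable⇒IsClique (cone-nonseparable xy xz path avoids) _ _
      (path⊆cone xy xz path avoids (Path-start∈ path)) (path⊆cone xy xz path avoids (Path-end∈ path)) y≢z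

module ConnectedBlockGraph {n} (G : Graph n) (connected : Connected G) (block-graph : IsBlockGraph G) where

  open GraphBasics G public
  open BlockGraph G block-graph public

  ¬cut⇒neighbours-adjacent : ∀ {x y z} → ¬ IsCutVertex G x → Adj G x y → Adj G x z → y ≢ z → Adj G y z
  ¬cut⇒neighbours-adjacent ¬cut xy xz y≢z = decidable-stable (Adj? _ _) λ ¬yz →
    ¬cut (_ , _ , ≢-sym (Adj⇒≢ xy) , ≢-sym (Adj⇒≢ xz) , connected _ _ ∈⊤ ∈⊤ ,
          λ walk → ¬yz (detour xy xz y≢z (WalkIn⇒avoiding walk)))

  closedNbhd : Fin n → Subset n
  closedNbhd x = toSubset (λ y → y ≟ᶠ x ⊎-dec Adj? x y)

  ∈-closedNbhd⁺ : ∀ {x y} → y ≡ x ⊎ Adj G x y → y ∈ closedNbhd x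
  ∈-closedNbhd⁺ {x} = ∈-toSubset⁺ (λ y → y ≟ᶠ x ⊎-dec Adj? x y)

  ∈-closedNbhd⁻ : ∀ {x y} → y ∈ closedNbhd x → y ≡ x ⊎ Adj G x y
  ∈-closedNbhd⁻ {x} = ∈-toSubset⁻ (λ y → y ≟ᶠ x ⊎-dec Adj? x y)

  closedNbhd-isClique : ∀ {x} → ¬ IsCutVertex G x → IsClique G (closedNbhd x)
  closedNbhd-isClique ¬cut i j i∈ j∈ i≢j with ∈-closedNbhd⁻ i∈ | ∈-closedNbhd⁻ j∈
  ... | inj₁ refl | inj₁ refl = ⊥-elim (i≢j refl)
  ... | inj₁ refl | inj₂ xj   = xj
  ... | inj₂ xi   | inj₁ refl = Adj-sym xi
  ... | inj₂ xi   | inj₂ xj   = ¬cut⇒neighbours-adjacent ¬cut xi xj i≢j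

  clique⊆closedNbhd : ∀ {S x} → IsClique G S → x ∈ S → S ⊆ closedNbhd x
  clique⊆closedNbhd {x = x} clique x∈ {y} y∈ with y ≟ᶠ x
  ... | yes y≡x = ∈-closedNbhd⁺ (inj₁ y≡x)
  ... | no y≢x  = ∈-closedNbhd⁺ (inj₂ (clique x y x∈ y∈ (≢-sym y≢x)))

  closedNbhd-isMaximalClique : ∀ {x} → ¬ IsCutVertex G x → IsMaximalClique G (closedNbhd x)
  closedNbhd-isMaximalClique ¬cut =
    closedNbhd-isClique ¬cut , λ S′ ⊆S′ clique → clique⊆closedNbhd clique (⊆S′ (∈-closedNbhd⁺ (inj₁ refl)))

  maximalClique≡closedNbhd : ∀ {S x} → IsMaximalClique G S → x ∈ S → ¬ IsCutVertex G x → S ≡ closedNbhd x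
  maximalClique≡closedNbhd (clique , maximal) x∈ ¬cut =
    ⊆-antisym S⊆ (maximal _ S⊆ (closedNbhd-isClique ¬cut))
    where
    S⊆ = clique⊆closedNbhd clique x∈

  cut⇒neighbour : ∀ {v} → IsCutVertex G v → ∃ λ y → y ≢ v × Adj G y v
  cut⇒neighbour {v} (u , _ , u≢v , _) =
    exit-edge (λ {_} {z} _ _ → ⊎-swap (toSum (z ≟ᶠ v))) (λ v≢v → v≢v refl)
              (fromWalkIn (connected u v ∈⊤ ∈⊤)) u≢v

  maximalClique-other : ∀ {S v} → IsMaximalClique G S → IsCutVertex G v → ∃ λ x → x ∈ S × x ≢ v
  maximalClique-other {S} {v} (_ , maximal) v-cut with any? (λ x → x ∈? S ×-dec ¬? (x ≟ᶠ v))
  ... | yes other = other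
  ... | no none with y , y≢v , yv ← cut⇒neighbour v-cut =
    ⊥-elim (none (y , maximal pair S⊆pair pair-isClique (∈-toSubset⁺ pair? (inj₂ refl)) , y≢v))
    where
    pair? : ∀ t → Dec (t ≡ v ⊎ t ≡ y)
    pair? t = t ≟ᶠ v ⊎-dec t ≟ᶠ y
    pair : Subset n
    pair = toSubset pair?
    S⊆pair : S ⊆ pair
    S⊆pair {x} x∈S with x ≟ᶠ v
    ... | yes x≡v = ∈-toSubset⁺ pair? (inj₁ x≡v)
    ... | no x≢v  = ⊥-elim (none (x , x∈S , x≢v))
    pair-isClique : IsClique G pair
    pair-isClique i j i∈ j∈ i≢j with ∈-toSubset⁻ pair? i∈ | ∈-toSubset⁻ pair? j∈
    ... | inj₁ refl | inj₂ refl = Adj-sym yv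
    ... | inj₂ refl | inj₁ refl = yv
    ... | inj₁ refl | inj₁ refl = ⊥-elim (i≢j refl)
    ... | inj₂ refl | inj₂ refl = ⊥-elim (i≢j refl)

  pendants≤leaves : ∀ {k} → PendantCount G k → ∀ T →
                    (∀ {S} → IsPendantClique G S → ∃ λ ℓ → ℓ ∈ S × ¬ IsCutVertex G ℓ × degree T ℓ ≡ 1) →
                    k ≤ leaves T
  pendants≤leaves (L , L-unique , L-pendant , _ , refl) T leaf-in =
    length-≤-by-injection (λ S ℓ → ℓ ∈ S × ¬ IsCutVertex G ℓ) L-unique image injective
    where
    image : ∀ {S} → S ∈ₗ L → ∃ λ ℓ → ℓ ∈ₗ filter (λ i → degree T i ≟ 1) (allFin n) × ℓ ∈ S × ¬ IsCutVertex G ℓ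
    image S∈ with ℓ , ℓ∈S , ¬cut , leaf ← leaf-in (All-lookup L-pendant S∈) =
      ℓ , ∈-filter⁺ (λ i → degree T i ≟ 1) (∈-allFin ℓ) leaf , ℓ∈S , ¬cut
    injective : ∀ {S S′ ℓ} → S ∈ₗ L → S′ ∈ₗ L →
                ℓ ∈ S × ¬ IsCutVertex G ℓ → ℓ ∈ S′ × ¬ IsCutVertex G ℓ → S ≡ S′
    injective S∈ S′∈ (ℓ∈S , ¬cut) (ℓ∈S′ , _) =
      trans (maximalClique≡closedNbhd (proj₁ (All-lookup L-pendant S∈)) ℓ∈S ¬cut)
            (≡.sym (maximalClique≡closedNbhd (proj₁ (All-lookup L-pendant S′∈)) ℓ∈S′ ¬cut))

  pendant-has-leaf : ∀ {T} → IsSpanningTree G T → ∀ {S} → IsPendantClique G S →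
                     ∃ λ ℓ → ℓ ∈ S × ¬ IsCutVertex G ℓ × degree T ℓ ≡ 1
  pendant-has-leaf {T} (T-sym , T⊆G , T-connected , T-acyclic) {S} (maxclique , v , _ , v-cut , only-v)
    with any? (λ ℓ → (ℓ ∈? S ×-dec ¬? (ℓ ≟ᶠ v)) ×-dec (degree T ℓ ≟ 1))
  ... | yes (ℓ , (ℓ∈S , ℓ≢v) , leaf) = ℓ , ℓ∈S , ¬cut (ℓ∈S , ℓ≢v) , leaf
    where
    ¬cut : ∀ {x} → x ∈ S × x ≢ v → ¬ IsCutVertex G x
    ¬cut (x∈S , x≢v) cut = x≢v (only-v _ x∈S cut)
  ... | no no-leaf =
    let x₁ , Wx₁ , x₁v = entry in ⊥-elim (no-endless-region T-irrefl T-acyclic continue (T-flip x₁v) Wx₁)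
    where
    W : Fin n → Set
    W x = x ∈ S × x ≢ v
    T-flip : ∀ {x y} → T x y ≡ true → T y x ≡ true
    T-flip {x} {y} = trans (T-sym y x)
    T-irrefl : ∀ {x} → ¬ T x x ≡ true
    T-irrefl {x} = Adj-irrefl ∘ T⊆G x x
    stays : ∀ {x y} → W x → T x y ≡ true → W y ⊎ y ≡ v
    stays {x} {y} (x∈S , x≢v) xy with y ≟ᶠ v
    ... | yes y≡v = inj₂ y≡v
    ... | no y≢v = inj₁ (subst (y ∈_) (≡.sym S≡) (∈-closedNbhd⁺ (inj₂ (T⊆G x y xy))) , y≢v)
      where
      S≡ : S ≡ closedNbhd x
      S≡ = maximalClique≡closedNbhd maxclique x∈S λ cut → x≢v (only-v _ x∈S cut)
    entry : ∃ λ x₁ → W x₁ × T x₁ v ≡ true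
    entry = let x₀ , x₀∈S , x₀≢v = maximalClique-other maxclique v-cut
            in exit-edge stays (λ (_ , v≢v) → v≢v refl) (fromWalkIn (T-connected x₀ v ∈⊤ ∈⊤)) (x₀∈S , x₀≢v)
    continue : ∀ {p x} → W x → T p x ≡ true → ∃ λ q → T x q ≡ true × p ≢ q × (W q ⊎ q ≡ v)
    continue {p} {x} Wx px =
      let q , xq , p≢q = another-true (T x) (λ leaf → no-leaf (x , Wx , leaf)) (T-flip px)
      in q , xq , p≢q , stays Wx xq

  module Layers (r : Fin n) where

    Within : ℕ → Fin n → Set
    Within zero    x = x ≡ r
    Within (suc m) x = Within m x ⊎ ∃ λ y → Within m y × Adj G y x

    within? : ∀ m x → Dec (Within m x)
    within? zero    x = x ≟ᶠ r
    within? (suc m) x = within? m x ⊎-dec any? (λ y → within? m y ×-dec Adj? y x)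

    private
      reachable : ∀ {m u x} → Within m u → WalkIn (Adj G) ⊤ u x → ∃ λ k → Within k x
      reachable w (here _)        = _ , w
      reachable w (step _ e walk) = reachable (inj₂ (_ , w , e)) walk

      shortest : ∀ x → ∃ λ m → Within m x × ∀ {k} → Within k x → m ≤ k
      shortest x = let k , w = reachable refl (connected r x ∈⊤ ∈⊤) in least-witness (λ m → within? m x) k w

    opaque
      depth : Fin n → ℕ
      depth x = proj₁ (shortest x)

      within-depth : ∀ x → Within (depth x) x
      within-depth x = proj₁ (proj₂ (shortest x))

      depth-least : ∀ {k x} → Within k x → depth x ≤ k
      depth-least {x = x} = proj₂ (proj₂ (shortest x))

    depth-root : depth r ≡ 0
    depth-root = n≤0⇒n≡0 (depth-least refl)

    depth≡0⇒root : ∀ {x} → depth x ≡ 0 → x ≡ r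
    depth≡0⇒root {x} eq = subst (λ m → Within m x) eq (within-depth x)

    depth≡suc⇒≢root : ∀ {x m} → depth x ≡ suc m → x ≢ r
    depth≡suc⇒≢root eq refl = 0≢1+n (trans (≡.sym depth-root) eq)

    depth-<⇒≢ : ∀ {x y} → depth x < depth y → x ≢ y
    depth-<⇒≢ x<y x≡y = <⇒≢ x<y (cong depth x≡y)

    layer-mate≢root : ∀ {y y′} → y ≢ y′ → depth y ≡ depth y′ → y ≢ r
    layer-mate≢root y≢y′ same refl = y≢y′ (≡.sym (depth≡0⇒root (trans (≡.sym same) depth-root)))

    depth-adj : ∀ {x y} → Adj G x y → depth y ≤ suc (depth x)
    depth-adj {x} e = depth-least (inj₂ (x , within-depth x , e))

    two-layers-apart⇒¬Adj : ∀ {x y} → depth y ≡ suc (suc (depth x)) → ¬ Adj G x y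
    two-layers-apart⇒¬Adj y-depth xy = 1+n≰n (subst (_≤ suc (depth _)) y-depth (depth-adj xy))

    lower-neighbour : ∀ {x} → x ≢ r → ∃ λ y → Adj G x y × suc (depth y) ≡ depth x
    lower-neighbour {x} x≢r with depth x in eq | within-depth x
    ... | zero  | _ = ⊥-elim (x≢r (depth≡0⇒root eq))
    ... | suc m | inj₁ w = ⊥-elim (1+n≰n (subst (_≤ m) eq (depth-least w)))
    ... | suc m | inj₂ (y , w , yx) =
      y , Adj-sym yx , ≤-antisym (s≤s (depth-least w)) (subst (_≤ suc (depth y)) eq (depth-adj yx))

    walk-down-avoiding : ∀ {y t} → t ≢ y → depth y ≤ depth t → Walk (Adj G) (_≢ t) y r
    walk-down-avoiding {y} = go (depth y) refl
      where
      go : ∀ m {y t} → depth y ≡ m → t ≢ y → depth y ≤ depth t → Walk (Adj G) (_≢ t) y r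
      go zero {y} eq t≢y _ with refl ← depth≡0⇒root {y} eq = stop (≢-sym t≢y)
      go (suc m) {y} {t} eq t≢y y≤t with a , ya , a↑ ← lower-neighbour (depth≡suc⇒≢root eq) =
        hop (≢-sym t≢y) ya (go m (suc-injective (trans a↑ eq)) (≢-sym (depth-<⇒≢ a<t)) (<⇒≤ a<t))
        where
        a<t : depth a < depth t
        a<t = ≤-trans (≤-reflexive a↑) y≤t

    walk-to-layer-one : ∀ {u} → u ≢ r → ∃ λ u₁ → depth u₁ ≡ 1 × Walk (Adj G) (_≢ r) u u₁
    walk-to-layer-one {u} = go (depth u) refl
      where
      go : ∀ m {u} → depth u ≡ m → u ≢ r → ∃ λ u₁ → depth u₁ ≡ 1 × Walk (Adj G) (_≢ r) u u₁
      go zero eq u≢r = ⊥-elim (u≢r (depth≡0⇒root eq))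
      go (suc zero) {u} eq u≢r = u , eq , stop u≢r
      go (suc (suc m)) eq u≢r =
        let a , ua , a↑          = lower-neighbour u≢r
            a-depth              = suc-injective (trans a↑ eq)
            u₁ , u₁-layer , walk = go (suc m) a-depth (depth≡suc⇒≢root a-depth)
        in u₁ , u₁-layer , hop u≢r ua walk

    neighbours-below-adjacent : ∀ {x y z} → Adj G x y → Adj G x z → y ≢ z →
                                depth y ≤ depth x → depth z ≤ depth x → Adj G y z
    neighbours-below-adjacent xy xz y≢z y≤x z≤x = detour xy xz y≢z
      (walk-down-avoiding (Adj⇒≢ xy) y≤x ++ʷ reverseʷ Adj-sym (walk-down-avoiding (Adj⇒≢ xz) z≤x))

    lower-neighbour-unique : ∀ {x y y′} → Adj G x y → Adj G x y′ →
                             suc (depth y) ≡ depth x → suc (depth y′) ≡ depth x → y ≡ y′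
    lower-neighbour-unique {x} {y} {y′} xy xy′ y↑ y′↑ with y ≟ᶠ y′
    ... | yes y≡y′ = y≡y′
    ... | no y≢y′
      with a , ya , a↑ ← lower-neighbour (layer-mate≢root y≢y′ (suc-injective (trans y↑ (≡.sym y′↑)))) =
      ⊥-elim (two-layers-apart⇒¬Adj x-depth (detour ya (Adj-sym xy) (depth-<⇒≢ a<x) a-to-x))
      where
      same-depth : depth y ≡ depth y′
      same-depth = suc-injective (trans y↑ (≡.sym y′↑))
      x-depth : depth x ≡ suc (suc (depth a))
      x-depth = trans (≡.sym y↑) (cong suc (≡.sym a↑))
      a<x : depth a < depth x
      a<x = ≤-trans (n≤1+n _) (≤-reflexive (≡.sym x-depth))
      a-to-x : Walk (Adj G) (_≢ y) a x
      a-to-x = walk-down-avoiding (Adj⇒≢ ya) (≤-trans (n≤1+n _) (≤-reflexive a↑))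
               ++ʷ reverseʷ Adj-sym (walk-down-avoiding y≢y′ (≤-reflexive (≡.sym same-depth)))
               ∷ʷʳ (Adj-sym xy′ , Adj⇒≢ xy)

    Deeper : Fin n → Fin n → Set
    Deeper x y = Adj G x y × depth y ≡ suc (depth x)

    deeper⇒cut : ∀ {x y} → x ≢ r → Deeper x y → IsCutVertex G x
    deeper⇒cut {x} {y} x≢r (xy , y↓) with a , xa , a↑ ← lower-neighbour x≢r =
      y , r , ≢-sym (Adj⇒≢ xy) , ≢-sym x≢r , connected y r ∈⊤ ∈⊤ ,
      λ avoiding → two-layers-apart⇒¬Adj y-depth (Adj-sym (detour xy xa y≢a (y-to-a avoiding)))
      where
      y-depth : depth y ≡ suc (suc (depth a))
      y-depth = trans y↓ (cong suc (≡.sym a↑))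
      y≢a : y ≢ a
      y≢a = ≢-sym (depth-<⇒≢ (≤-trans (n≤1+n _) (≤-reflexive (≡.sym y-depth))))
      y-to-a : WalkIn (Adj G) (⊤ - x) y r → Walk (Adj G) (_≢ x) y a
      y-to-a avoiding = WalkIn⇒avoiding avoiding
                        ++ʷ reverseʷ Adj-sym (walk-down-avoiding (Adj⇒≢ xa) (≤-trans (n≤1+n _) (≤-reflexive a↑)))

    private
      descent-or-deeper : ∀ {u x} → u ≢ x → Walk (Adj G) (_≢ x) u r ⊎ ∃ (Deeper x)
      descent-or-deeper {u} = go (depth u) refl
        where
        go : ∀ m {u x} → depth u ≡ m → u ≢ x → Walk (Adj G) (_≢ x) u r ⊎ ∃ (Deeper x)
        go zero {u} eq u≢x with refl ← depth≡0⇒root {u} eq = inj₁ (stop u≢x)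
        go (suc m) {u} {x} eq u≢x with a , ua , a↑ ← lower-neighbour (depth≡suc⇒≢root eq) with a ≟ᶠ x
        ... | yes refl = inj₂ (u , Adj-sym ua , ≡.sym a↑)
        ... | no a≢x   = ⊎-map (hop u≢x ua) (λ d → d) (go m (suc-injective (trans a↑ eq)) a≢x)

    cut⇒deeper : ∀ {x} → IsCutVertex G x → ∃ (Deeper x)
    cut⇒deeper (u , w , u≢x , w≢x , _ , ¬avoiding) with descent-or-deeper u≢x | descent-or-deeper w≢x
    ... | inj₂ d | _      = d
    ... | inj₁ _ | inj₂ d = d
    ... | inj₁ p | inj₁ q = ⊥-elim (¬avoiding (avoiding⇒WalkIn (p ++ʷ reverseʷ Adj-sym q)))

  module SpanningTree (r : Fin n) (r-cut : IsCutVertex G r) where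

    open Layers r

    deeper? : ∀ x → Dec (∃ (Deeper x))
    deeper? x = any? (λ y → Adj? x y ×-dec (depth y ≟ suc (depth x)))

    bit : Fin n → ℕ
    bit x = if does (deeper? x) then 1 else 0

    -- Vertices are ordered by layer, then those without deeper neighbours first, then by index.
    opaque
      rank : Fin n → ℕ
      rank x = depth x * 2 + bit x

      key : Fin n → ℕ
      key x = rank x * n + toℕ x

      bit<2 : ∀ x → bit x < 2
      bit<2 x with does (deeper? x)
      ... | true  = ≤-refl
      ... | false = s≤s z≤n

      key-depth-< : ∀ {x y} → depth x < depth y → key x < key y
      key-depth-< {x} {y} x<y =
        mixed-radix-< {n} {rank x} {rank y} (mixed-radix-< {2} x<y (bit<2 x)) (toℕ<n x)

      key-≤⇒depth-≤ : ∀ {x y} → key x ≤ key y → depth x ≤ depth y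
      key-≤⇒depth-≤ {x} {y} x≤y =
        mixed-radix-≤⁻ {2} (mixed-radix-≤⁻ {n} {rank x} {rank y} x≤y (toℕ<n y)) (bit<2 y)

      key-injective : ∀ {x y} → key x ≡ key y → x ≡ y
      key-injective {x} {y} x≡y =
        toℕ-injective (mixed-radix-injective {n} {rank x} {rank y} x≡y (toℕ<n x) (toℕ<n y))

      key-bit-< : ∀ {x y} → depth x ≡ depth y → ¬ ∃ (Deeper x) → ∃ (Deeper y) → key x < key y
      key-bit-< {x} {y} same ¬deeper deeper = mixed-radix-< {n} {rank x} {rank y} rank< (toℕ<n x)
        where
        rank< : rank x < rank y
        rank< rewrite dec-false (deeper? x) ¬deeper | dec-true (deeper? y) deeper | same =
          +-monoʳ-< (depth y * 2) (s≤s z≤n)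

    key-<⇒depth-≤ : ∀ {x y} → key x < key y → depth x ≤ depth y
    key-<⇒depth-≤ = key-≤⇒depth-≤ ∘ <⇒≤

    key-<⇒≢ : ∀ {x y} → key x < key y → x ≢ y
    key-<⇒≢ x<y x≡y = <⇒≢ x<y (cong key x≡y)

    key-root≤ : ∀ x → key r ≤ key x
    key-root≤ x = by-cases (x ≟ᶠ r)
      where
      by-cases : Dec (x ≡ r) → key r ≤ key x
      by-cases (yes x≡r) = ≤-reflexive (cong key (≡.sym x≡r))
      by-cases (no x≢r)  =
        <⇒≤ (key-depth-< (subst (_< depth x) (≡.sym depth-root) (n≢0⇒n>0 (x≢r ∘ depth≡0⇒root))))

    Below : Fin n → Fin n → Set
    Below x y = Adj G x y × key y < key x

    below? : ∀ x y → Dec (Below x y)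
    below? x y = Adj? x y ×-dec (key y <? key x)

    IsParent : Fin n → Fin n → Set
    IsParent x p = Below x p × ∀ {z} → Below x z → key z ≤ key p

    parent : Fin n → Fin n
    parent x with any? (below? x)
    ... | yes (_ , below) = proj₁ (greatest-by (below? x) key below)
    ... | no _            = r

    parent-isParent : ∀ {x} → x ≢ r → IsParent x (parent x)
    parent-isParent {x} x≢r with any? (below? x)
    ... | yes (_ , below) = proj₂ (greatest-by (below? x) key below)
    ... | no none with a , xa , a↑ ← lower-neighbour x≢r =
      ⊥-elim (none (a , xa , key-depth-< (≤-reflexive a↑)))

    isParent⇒parent : ∀ {x p} → x ≢ r → IsParent x p → parent x ≡ p
    isParent⇒parent x≢r (p-below , p-greatest) with q-below , q-greatest ← parent-isParent x≢r =
      key-injective (≤-antisym (p-greatest q-below) (q-greatest p-below))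

    open ParentTree r parent key (λ x≢r → proj₂ (proj₁ (parent-isParent x≢r))) public

    tree-isSpanningTree : IsSpanningTree G tree
    tree-isSpanningTree = isSpanningTree G (λ x≢r → proj₁ (proj₁ (parent-isParent x≢r)))

    -- Closure under stepping down leaves the least member no parent candidate above x.
    least-is-child : ∀ {x} {C : Fin n → Set} → Decidable C → (∀ {c} → C c → Below c x) →
                     (∀ {c z} → C c → Below c z → key x < key z → C z) →
                     ∀ {c} → C c → ∃ λ m → C m × ChildOf m x
    least-is-child {x} C? above closed Cc with m , Cm , m-least ← least-by C? key Cc =
      m , Cm , m≢r , isParent⇒parent m≢r (above Cm , no-better)
      where
      m≢r : m ≢ r
      m≢r m≡r = <⇒≱ (proj₂ (above Cm)) (subst (λ t → key t ≤ key x) (≡.sym m≡r) (key-root≤ x))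
      no-better : ∀ {z} → Below m z → key z ≤ key x
      no-better z-below = ≮⇒≥ λ x<z → <⇒≱ (proj₂ z-below) (m-least (closed Cm z-below x<z))

    layer-mate-child : ∀ {x y} → Adj G x y → depth y ≡ depth x → key x < key y → ∃ λ c → ChildOf c x
    layer-mate-child {x} xy y-layer x<y =
      let c , _ , child = least-is-child C? above closed (xy , y-layer , x<y) in c , child
      where
      C : Fin n → Set
      C c = Adj G x c × depth c ≡ depth x × key x < key c
      C? : Decidable C
      C? c = Adj? x c ×-dec (depth c ≟ depth x) ×-dec (key x <? key c)
      above : ∀ {c} → C c → Below c x
      above (xc , _ , x<c) = Adj-sym xc , x<c
      closed : ∀ {c z} → C c → Below c z → key x < key z → C z
      closed (xc , c-layer , _) (cz , z<c) x<z = xz , z-layer , x<z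
        where
        z-layer = ≤-antisym (≤-trans (key-<⇒depth-≤ z<c) (≤-reflexive c-layer)) (key-<⇒depth-≤ x<z)
        xz = neighbours-below-adjacent (Adj-sym xc) cz (key-<⇒≢ x<z)
               (≤-reflexive (≡.sym c-layer)) (≤-reflexive (trans z-layer (≡.sym c-layer)))

    deeper-child : ∀ {x y} → Deeper x y → ∃ λ c → ChildOf c x
    deeper-child {x} deeper = let c , _ , child = least-is-child C? above closed deeper in c , child
      where
      C : Fin n → Set
      C = Deeper x
      C? : Decidable C
      C? c = Adj? x c ×-dec (depth c ≟ suc (depth x))
      above : ∀ {c} → C c → Below c x
      above (xc , c↓) = Adj-sym xc , key-depth-< (≤-reflexive (≡.sym c↓))
      closed : ∀ {c z} → C c → Below c z → key x < key z → C z
      closed (xc , c↓) (cz , z<c) x<z with m≤n⇒m<n∨m≡n (≤-trans (key-<⇒depth-≤ z<c) (≤-reflexive c↓))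
      ... | inj₂ z↓ = neighbours-below-adjacent (Adj-sym xc) cz (key-<⇒≢ x<z)
                        (≤-trans (n≤1+n _) (≤-reflexive (≡.sym c↓))) (≤-reflexive (trans z↓ (≡.sym c↓))) , z↓
      ... | inj₁ z<↓ = ⊥-elim (key-<⇒≢ x<z (≡.sym (lower-neighbour-unique cz (Adj-sym xc) z↑ (≡.sym c↓))))
        where
        z↑ = trans (cong suc (≤-antisym (≤-pred z<↓) (key-<⇒depth-≤ x<z))) (≡.sym c↓)

    Clan : Fin n → Fin n → Set
    Clan u₁ c = depth c ≡ 1 × (c ≡ u₁ ⊎ Adj G u₁ c)

    clan-walk : ∀ {u₁ c} → depth u₁ ≡ 1 → Clan u₁ c → Walk (Adj G) (_≢ r) u₁ c
    clan-walk u₁-layer (_ , inj₁ refl)       = stop (depth≡suc⇒≢root u₁-layer)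
    clan-walk u₁-layer (c-layer , inj₂ u₁c) =
      hop (depth≡suc⇒≢root u₁-layer) u₁c (stop (depth≡suc⇒≢root c-layer))

    layer-one-child : ∀ {u₁} → depth u₁ ≡ 1 → ∃ λ c → Clan u₁ c × ChildOf c r
    layer-one-child {u₁} u₁-layer = least-is-child C? above closed (u₁-layer , inj₁ refl)
      where
      C? : Decidable (Clan u₁)
      C? c = (depth c ≟ 1) ×-dec (c ≟ᶠ u₁ ⊎-dec Adj? u₁ c)
      above : ∀ {c} → Clan u₁ c → Below c r
      above (c-layer , _) with a , ca , a↑ ← lower-neighbour (depth≡suc⇒≢root c-layer) =
        subst (Adj G _) (depth≡0⇒root (suc-injective (trans a↑ c-layer))) ca ,
        key-depth-< (subst₂ _<_ (≡.sym depth-root) (≡.sym c-layer) (s≤s z≤n))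
      closed : ∀ {c z} → Clan u₁ c → Below c z → key r < key z → Clan u₁ z
      closed {c} {z} (c-layer , c-clan) (cz , z<c) r<z = z-layer , z-clan c-clan
        where
        z≤c : depth z ≤ depth c
        z≤c = key-<⇒depth-≤ z<c
        z-layer : depth z ≡ 1
        z-layer = ≤-antisym (≤-trans z≤c (≤-reflexive c-layer))
                            (n≢0⇒n>0 λ z-root → key-<⇒≢ r<z (≡.sym (depth≡0⇒root z-root)))
        z-clan : c ≡ u₁ ⊎ Adj G u₁ c → z ≡ u₁ ⊎ Adj G u₁ z
        z-clan (inj₁ refl) = inj₂ cz
        z-clan (inj₂ u₁c) with z ≟ᶠ u₁
        ... | yes z≡u₁ = inj₁ z≡u₁
        ... | no z≢u₁  = inj₂ (neighbours-below-adjacent (Adj-sym u₁c) cz (≢-sym z≢u₁)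
                                 (≤-reflexive (trans u₁-layer (≡.sym c-layer))) z≤c)

    root-degree≢1 : degree tree r ≢ 1
    root-degree≢1 = two-children r-cut
      where
      two-children : IsCutVertex G r → degree tree r ≢ 1
      two-children (u , w , u≢r , w≢r , _ , ¬avoiding)
        with u₁ , u₁-layer , u-walk ← walk-to-layer-one u≢r
           | w₁ , w₁-layer , w-walk ← walk-to-layer-one w≢r
        with cu , cu-clan , cu-child ← layer-one-child u₁-layer
           | cw , cw-clan , cw-child ← layer-one-child w₁-layer
        with cu ≟ᶠ cw
      ... | yes refl = ⊥-elim (¬avoiding (avoiding⇒WalkIn
            (u-walk ++ʷ clan-walk u₁-layer cu-clan ++ʷ
             reverseʷ Adj-sym (clan-walk w₁-layer cw-clan) ++ʷ reverseʷ Adj-sym w-walk)))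
      ... | no cu≢cw = degree≢1 (inj₂ cu-child) (inj₂ cw-child) cu≢cw

    -- x is last on the path along which the tree runs through its block, and no deeper block hangs from x.
    Terminal : Fin n → Set
    Terminal x = x ≢ r × ¬ ∃ (Deeper x) × (∀ {y} → Adj G x y → depth y ≡ depth x → key y < key x)

    leaf⇒terminal : ∀ {x} → degree tree x ≡ 1 → Terminal x
    leaf⇒terminal {x} leaf = x≢r , (λ (_ , deeper) → no-child (deeper-child deeper)) , last
      where
      x≢r : x ≢ r
      x≢r x≡r = root-degree≢1 (subst (λ t → degree tree t ≡ 1) x≡r leaf)
      no-child : ¬ ∃ λ c → ChildOf c x
      no-child (_ , child) = degree≢1-if-child x≢r child leaf
      last : ∀ {y} → Adj G x y → depth y ≡ depth x → key y < key x
      last xy y-layer = decidable-stable (_ <? _) λ y≮x →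
        no-child (layer-mate-child xy y-layer (≤∧≢⇒< (≮⇒≥ y≮x) (Adj⇒≢ xy ∘ key-injective)))

    lower⇒cut : ∀ {x a} → Adj G x a → suc (depth a) ≡ depth x → IsCutVertex G a
    lower⇒cut {a = a} xa a↑ with a ≟ᶠ r
    ... | yes a≡r = subst (IsCutVertex G) (≡.sym a≡r) r-cut
    ... | no a≢r  = deeper⇒cut a≢r (Adj-sym xa , ≡.sym a↑)

    terminal⇒¬cut : ∀ {x} → Terminal x → ¬ IsCutVertex G x
    terminal⇒¬cut (_ , ¬deeper , _) = ¬deeper ∘ cut⇒deeper

    terminal⇒pendant : ∀ {ℓ} → Terminal ℓ → IsPendantClique G (closedNbhd ℓ)
    terminal⇒pendant {ℓ} t@(ℓ≢r , ¬deeper , last) with a , ℓa , a↑ ← lower-neighbour ℓ≢r =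
      closedNbhd-isMaximalClique (terminal⇒¬cut t) , a , ∈-closedNbhd⁺ (inj₂ ℓa) , lower⇒cut ℓa a↑ , only-a
      where
      only-a : ∀ w → w ∈ closedNbhd ℓ → IsCutVertex G w → w ≡ a
      only-a w w∈ w-cut with ∈-closedNbhd⁻ w∈
      ... | inj₁ refl = ⊥-elim (terminal⇒¬cut t w-cut)
      ... | inj₂ ℓw with <-cmp (depth w) (depth ℓ)
      ...   | tri< w<ℓ _ _ = lower-neighbour-unique ℓw ℓa (≤-antisym w<ℓ (depth-adj (Adj-sym ℓw))) a↑
      ...   | tri≈ _ w≈ℓ _ = ⊥-elim (<-asym (last ℓw w≈ℓ) (key-bit-< (≡.sym w≈ℓ) ¬deeper (cut⇒deeper w-cut)))
      ...   | tri> _ _ ℓ<w = ⊥-elim (¬deeper (w , ℓw , ≤-antisym (depth-adj ℓw) ℓ<w))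

    terminal-injective : ∀ {ℓ ℓ′} → Terminal ℓ → Terminal ℓ′ → closedNbhd ℓ ≡ closedNbhd ℓ′ → ℓ ≡ ℓ′
    terminal-injective {ℓ} {ℓ′} (_ , ¬deeper , last) (_ , ¬deeper′ , last′) same
      with ∈-closedNbhd⁻ (subst (ℓ′ ∈_) (≡.sym same) (∈-closedNbhd⁺ (inj₁ refl)))
    ... | inj₁ ℓ′≡ℓ = ≡.sym ℓ′≡ℓ
    ... | inj₂ ℓℓ′ with <-cmp (depth ℓ) (depth ℓ′)
    ...   | tri< ℓ<ℓ′ _ _ = ⊥-elim (¬deeper (ℓ′ , ℓℓ′ , ≤-antisym (depth-adj ℓℓ′) ℓ<ℓ′))
    ...   | tri≈ _ ℓ≈ℓ′ _ = ⊥-elim (<-asym (last ℓℓ′ (≡.sym ℓ≈ℓ′)) (last′ (Adj-sym ℓℓ′) ℓ≈ℓ′))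
    ...   | tri> _ _ ℓ′<ℓ = ⊥-elim (¬deeper′ (ℓ , Adj-sym ℓℓ′ , ≤-antisym (depth-adj (Adj-sym ℓℓ′)) ℓ′<ℓ))

    tree-leaves≤ : ∀ {k} → PendantCount G k → leaves tree ≤ k
    tree-leaves≤ (L , _ , _ , L-complete , refl) =
      length-≤-by-injection (λ ℓ S → S ≡ closedNbhd ℓ) (filter⁺ leaf? (allFin⁺ n)) image injective
      where
      leaf? : ∀ x → Dec (degree tree x ≡ 1)
      leaf? x = degree tree x ≟ 1
      terminal : ∀ {ℓ} → ℓ ∈ₗ filter leaf? (allFin n) → Terminal ℓ
      terminal ℓ∈ = leaf⇒terminal (proj₂ (∈-filter⁻ leaf? {xs = allFin n} ℓ∈))
      image : ∀ {ℓ} → ℓ ∈ₗ filter leaf? (allFin n) → ∃ λ S → S ∈ₗ L × S ≡ closedNbhd ℓ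
      image ℓ∈ = _ , L-complete _ (terminal⇒pendant (terminal ℓ∈)) , refl
      injective : ∀ {ℓ ℓ′ S} → ℓ ∈ₗ filter leaf? (allFin n) → ℓ′ ∈ₗ filter leaf? (allFin n) →
                  S ≡ closedNbhd ℓ → S ≡ closedNbhd ℓ′ → ℓ ≡ ℓ′
      injective ℓ∈ ℓ′∈ refl same = terminal-injective (terminal ℓ∈) (terminal ℓ′∈) same

proposition1 : ∀ {n} (G : Graph n) → Connected G → IsBlockGraph G →
    ∃[ c ] IsCutVertex G c →
    ∀ k → PendantCount G k →
      (Σ (Fin n → Fin n → Bool) λ T → IsSpanningTree G T × leaves T ≡ k) ×
      (∀ T → IsSpanningTree G T → k ≤ leaves T)
proposition1 G connected block-graph (r , r-cut) k count =
  (tree , tree-isSpanningTree , ≤-antisym (tree-leaves≤ count) (at-least tree-isSpanningTree)) ,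
  λ _ → at-least
  where
  open ConnectedBlockGraph G connected block-graph
  open SpanningTree r r-cut
  at-least : ∀ {T} → IsSpanningTree G T → k ≤ leaves T
  at-least T-spanning = pendants≤leaves count _ (pendant-has-leaf T-spanning)
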